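{- Let $p$ be a prime, $d\ge1$, $\ell$ a primitive divisor of $p^d-1$, and let $G=N{:}H\le\mathrm{AGL}(1,p^d)$ where $N\cong\mathbb{Z}_p^d$ is the translation subgroup and $H=\langle h\rangle\le\mathrm{GL}(1,p^d)$ has order $\ell$. Let $x_1,x_2\in N\setminus\{1\}$ and let $0\le i_1,i_2,j_1,j_2\le\ell-1$ with $\gcd(j_1,\ell)=\gcd(j_2,\ell)=1$. For $t=1,2$ put $b_t=h^{i_t}x_t$ and $w_t=x_t^{ -1}h^{j_t-i_t}$. Then the following are equivalent: (i) $\mathcal{D}(G,b_1,w_1)\cong\mathcal{D}(G,b_2,w_2)$; (ii) there is $k$ with $0\le k\le d-1$ such that $i_2\equiv i_1p^k\pmod\ell$ and $j_2\equiv j_1p^k\pmod\ell$.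
   Context: An integer $\ell$ is a primitive divisor of $p^d-1$ if $\ell\mid p^d-1$ but $\ell\nmid p^i-1$ for all $1\le i<d$. For a finite group $G=\langle b,w\rangle$, $\mathcal{D}(G,b,w)$ is the regular dessin with black vertices the right cosets of $\langle b\rangle$, white vertices the right cosets of $\langle w\rangle$, edges the elements of $G$, faces corresponding to right cosets of $\langle bw\rangle$; isomorphisms of dessins preserve colours, incidence and orientation. -}

module Defs where

open import Level using (Level; suc; zero)
open import Data.Nat as ℕ using (ℕ; NonZero; _≤_; _<_; _∸_)
open import Data.Nat.DivMod using (_mod_)
open import Data.Nat.Divisibility using (_∣_)
open import Data.Fin using (Fin; toℕ)
open import Data.Product using (_×_; _,_; Σ; ∃)
open import Relation.Binary.PropositionalEquality using (_≡_)
open import Relation.Nullary using (¬_)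
open import Function.Bundles using (_↔_; Inverse)
open import Algebra.Structures using (IsCommutativeRing)

PrimitiveDivisor : ℕ → ℕ → ℕ → Set
PrimitiveDivisor ℓ p d =
  (ℓ ∣ (p ℕ.^ d) ∸ 1) × (∀ i → 1 ≤ i → i < d → ¬ (ℓ ∣ (p ℕ.^ i) ∸ 1))

record FiniteField (q : ℕ) : Set₁ where
  infixl 7 _*_
  infixl 6 _+_
  field
    Carrier : Set
    _+_ _*_ : Carrier → Carrier → Carrier
    -_      : Carrier → Carrier
    0F 1F   : Carrier
    isCommutativeRing : IsCommutativeRing _≡_ _+_ _*_ -_ 0F 1F
    0≢1     : ¬ (0F ≡ 1F)
    inverse : ∀ a → ¬ (a ≡ 0F) → ∃ λ b → a * b ≡ 1F
    enumeration : Fin q ↔ Carrier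

  _^_ : Carrier → ℕ → Carrier
  a ^ ℕ.zero  = 1F
  a ^ ℕ.suc n = a * (a ^ n)

  HasOrder : Carrier → ℕ → Set
  HasOrder h ℓ = (h ^ ℓ ≡ 1F) × (∀ k → 1 ≤ k → k < ℓ → ¬ (h ^ k ≡ 1F))

-- Combinatorial (oriented, bicoloured) dessin: edge set with the rotations
-- around black and around white vertices.
record Dessin : Set₁ where
  field
    Edge : Set
    ρb ρw : Edge → Edge

-- Isomorphism of dessins: a bijection of edges commuting with both rotations
-- (hence preserving colours, incidence and orientation).
_≅D_ : Dessin → Dessin → Set
D₁ ≅D D₂ =
  Σ (Dessin.Edge D₁ ↔ Dessin.Edge D₂) λ φ →
    (∀ e → Inverse.to φ (Dessin.ρb D₁ e) ≡ Dessin.ρb D₂ (Inverse.to φ e)) ×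
    (∀ e → Inverse.to φ (Dessin.ρw D₁ e) ≡ Dessin.ρw D₂ (Inverse.to φ e))

-- The regular dessin D(G,b,w) of a group G: edges are the elements of G;
-- the black vertex ⟨b⟩g has edges b^k g, rotated by g ↦ b g; similarly white.
regDessin : (G : Set) → (G → G → G) → G → G → Dessin
regDessin G _·_ b w = record { Edge = G ; ρb = λ g → b · g ; ρw = λ g → w · g }

-- Element (i , c) is the affine map v ↦ h^i v + c; products are composition
-- with right-action convention (g · g' = first g, then g').
module AffineGroup {q : ℕ} (F : FiniteField q) (ℓ : ℕ) .{{_ : NonZero ℓ}}
                   (h : FiniteField.Carrier F) where
  open FiniteField F

  G : Set
  G = Fin ℓ × Carrier

  _·_ : G → G → G
  (i , c) · (i' , c') = ((toℕ i ℕ.+ toℕ i') mod ℓ , (h ^ toℕ i') * c + c')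

  hpow : ℕ → G
  hpow k = (k mod ℓ , 0F)

  trans : Carrier → G
  trans c = (0 mod ℓ , c)

  bElt : ℕ → Carrier → G
  bElt i c = hpow i · trans c

  -- w = x_c^{-1} h^{j-i}, with 0 ≤ i ≤ ℓ-1 so j - i ≡ j + (ℓ - i) (mod ℓ)
  wElt : ℕ → ℕ → Carrier → G
  wElt i j c = trans (- c) · hpow (j ℕ.+ (ℓ ∸ i))

  D : G → G → Dessin
  D b w = regDessin G _·_ b w

{-# OPTIONS --safe #-}
-- (ii) ⇒ (i): the map (a, c) ↦ (pᵏa, λ c^{pᵏ}) of G = N:H, a power of Frobenius followed by the scaling λ that
-- sends c₁^{pᵏ} to c₂, is an automorphism of G taking b₁, w₁ to b₂, w₂, hence an isomorphism of the dessins.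
--
-- (i) ⇒ (ii): an isomorphism φ of the dessins satisfies φ(b₁x) = b₂φ(x) and φ(w₁x) = w₂φ(x), so φ intertwines
-- left multiplication by b₁w₁ = h^{j₁} with that by h^{j₂}. As j₁ is a unit mod ℓ, some h^{mj₁}b₁ is the translation
-- by c₁; the matching h^{mj₂}b₂ is then a translation too, since its p-th power is trivial and p is prime to ℓ.
-- Conjugating by h^{j_t} and adding, φ intertwines the translations by f(ζ₁)c₁ and f(ζ₂)c₂ for every monic
-- f ∈ 𝔽ₚ[x], where ζ_t = h^{j_t}. For f = ∏_{k<d} (x − ζ₁^{pᵏ}), whose coefficients lie in 𝔽ₚ because Frobenius
-- permutes its roots, f(ζ₁) = 0 forces f(ζ₂) = 0, so ζ₂ = ζ₁^{pᵏ}: this is j₂ ≡ j₁pᵏ, and i₂ ≡ −mj₂ ≡ i₁pᵏ.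
module Submission where

open import Algebra.Bundles using (CommutativeRing)
open import Algebra.Structures using (IsCommutativeRing)
open import Data.Empty using (⊥-elim)
open import Data.Fin as Fin using (Fin; toℕ; fromℕ; punchOut)
open import Data.Fin.Permutation using (Permutation; _⟨$⟩ʳ_)
import Data.Fin.Properties as Fin
open import Data.List using (List; []; _∷_; length; map; _∷ʳ_; [_]; replicate; applyUpTo)
open import Data.List.Properties using (∷-injectiveˡ; ∷-injectiveʳ; length-replicate; length-applyUpTo; map-applyUpTo; applyUpTo-∷ʳ)
open import Data.List.Relation.Unary.All as All using (All; []; _∷_)
import Data.List.Relation.Unary.All.Properties as Allₚ
open import Data.List.Relation.Unary.AllPairs using (AllPairs; []; _∷_)
import Data.List.Relation.Unary.AllPairs.Properties as AllPairsₚ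
open import Data.List.Relation.Unary.Any as Any using (Any; here; there)
import Data.List.Relation.Unary.Any.Properties as Anyₚ
open import Data.Nat as ℕ using (ℕ; zero; suc; NonZero; >-nonZero; >-nonZero⁻¹; _∸_; _≤_; _<_; z≤n; s≤s)
open import Data.Nat.Combinatorics using (_C_; nC1≡n; nCn≡1; nCk+nC[k+1]≡[n+1]C[k+1])
open import Data.Nat.Coprimality using (Coprime; coprime-Bézout; coprime-divisor; gcd≡1⇒coprime; prime⇒coprime)
open import Data.Nat.DivMod using (_%_; _mod_; %-distribˡ-+; %-distribˡ-*; [m+kn]%n≡m%n; m<n⇒m%n≡m; m%n%n≡m%n; m%n<n; m≡m%n+[m/n]*n; _/_)
open import Data.Nat.Divisibility using (_∣_; divides; ∣⇒≤; ∣-trans; ∣m+n∣m⇒∣n; ∣1⇒≡1; m∣m*n; m%n≡0⇒n∣m; n∣m⇒m%n≡0)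
open import Data.Nat.GCD using (gcd; module Bézout)
open import Data.Nat.Primality using (Prime; euclidsLemma; prime⇒nonZero; prime⇒nonTrivial)
import Data.Nat.Properties as ℕₚ
open import Data.Nat.Solver using (module +-*-Solver)
open import Data.Product using (∃; _×_; _,_; proj₁; proj₂)
open import Data.Product.Function.NonDependent.Propositional using (_×-↔_)
open import Data.Sum using (_⊎_; inj₁; inj₂)
open import Data.Vec.Functional using (rearrange; init; tail)
open import Defs
open import Function.Base using (_∘_)
open import Function.Bundles using (_↔_; _⇔_; Inverse; Injection; mk↔ₛ′; mk⇔)
open import Function.Construct.Composition using (_↔-∘_)
open import Function.Construct.Identity using (↔-id)
open import Function.Construct.Symmetry using (↔-sym)
open import Function.Definitions using (Injective)
open import Function.Properties.Inverse using (↔⇒↣)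
open import Level using (0ℓ)
open import Relation.Binary.Definitions using (DecidableEquality; tri<; tri≈; tri>)
open import Relation.Binary.PropositionalEquality hiding ([_])
open import Relation.Nullary using (¬_; yes; no)
import Relation.Nullary.Decidable as Dec

open ≡-Reasoning

module _ where

  open import Data.Nat using (_+_; _*_; _^_)
  open +-*-Solver using (solve; _:=_; _:+_; _:*_; con)

  [1+k]*[1+n]C[1+k]≡[1+n]*nCk : ∀ n k → suc k * (suc n C suc k) ≡ suc n * (n C k)
  [1+k]*[1+n]C[1+k]≡[1+n]*nCk zero    zero    = refl
  [1+k]*[1+n]C[1+k]≡[1+n]*nCk zero    (suc k) = ℕₚ.*-zeroʳ (suc (suc k))
  [1+k]*[1+n]C[1+k]≡[1+n]*nCk (suc n) zero    = begin
    1 * (suc (suc n) C 1) ≡⟨ ℕₚ.*-identityˡ _ ⟩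
    suc (suc n) C 1       ≡⟨ nC1≡n (suc (suc n)) ⟩
    suc (suc n)           ≡⟨ ℕₚ.*-identityʳ _ ⟨
    suc (suc n) * 1       ∎
  [1+k]*[1+n]C[1+k]≡[1+n]*nCk (suc n) (suc k) = begin
    suc (suc k) * (suc (suc n) C suc (suc k))          ≡⟨ cong (suc (suc k) *_) (nCk+nC[k+1]≡[n+1]C[k+1] (suc n) (suc k)) ⟨
    suc (suc k) * (A + B)                              ≡⟨ ℕₚ.*-distribˡ-+ (suc (suc k)) A B ⟩
    (A + suc k * A) + suc (suc k) * B                  ≡⟨ cong₂ (λ a b → (A + a) + b) ([1+k]*[1+n]C[1+k]≡[1+n]*nCk n k)
                                                                                    ([1+k]*[1+n]C[1+k]≡[1+n]*nCk n (suc k)) ⟩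
    (A + suc n * (n C k)) + suc n * (n C suc k)        ≡⟨ ℕₚ.+-assoc A _ _ ⟩
    A + (suc n * (n C k) + suc n * (n C suc k))        ≡⟨ cong (A +_) (ℕₚ.*-distribˡ-+ (suc n) (n C k) (n C suc k)) ⟨
    A + suc n * (n C k + n C suc k)                    ≡⟨ cong (λ t → A + suc n * t) (nCk+nC[k+1]≡[n+1]C[k+1] n k) ⟩
    suc (suc n) * A                                    ∎
    where
    A = suc n C suc k
    B = suc n C suc (suc k)

  prime∣pCk : ∀ {p k} → Prime p → 0 < k → k < p → p ∣ p C k
  prime∣pCk {suc n} {suc k} pr _ k<p
    with euclidsLemma (suc k) (suc n C suc k) pr
           (divides (n C k) (trans ([1+k]*[1+n]C[1+k]≡[1+n]*nCk n k) (ℕₚ.*-comm (suc n) (n C k))))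
  ... | inj₁ p∣k   = ⊥-elim (ℕₚ.<⇒≱ k<p (∣⇒≤ p∣k))
  ... | inj₂ p∣pCk = p∣pCk

  ∣m^[1+d]∸1⇒coprime : ∀ {ℓ m d} → 0 < m → ℓ ∣ m ^ suc d ∸ 1 → Coprime ℓ m
  ∣m^[1+d]∸1⇒coprime {ℓ} {m} {d} m>0 ℓ∣ {i} (i∣ℓ , i∣m) = ∣1⇒≡1 (∣m+n∣m⇒∣n i∣m^[1+d] (∣-trans i∣ℓ ℓ∣))
    where
    i∣m^[1+d] : i ∣ (m ^ suc d ∸ 1) + 1
    i∣m^[1+d] = subst (i ∣_) (sym (ℕₚ.m∸n+n≡m (ℕₚ.m^n>0 m {{>-nonZero m>0}} (suc d)))) (∣-trans i∣m (m∣m*n (m ^ d)))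

  module Modular (ℓ : ℕ) .{{_ : NonZero ℓ}} where

    infix 4 _≡ₘ_
    _≡ₘ_ : ℕ → ℕ → Set
    a ≡ₘ b = a % ℓ ≡ b % ℓ

    +-congₘ : ∀ {a b c d} → a ≡ₘ b → c ≡ₘ d → a + c ≡ₘ b + d
    +-congₘ {a} {b} {c} {d} a≡b c≡d = begin
      (a + c) % ℓ               ≡⟨ %-distribˡ-+ a c ℓ ⟩
      (a % ℓ + c % ℓ) % ℓ       ≡⟨ cong₂ (λ u v → (u + v) % ℓ) a≡b c≡d ⟩
      (b % ℓ + d % ℓ) % ℓ       ≡⟨ %-distribˡ-+ b d ℓ ⟨
      (b + d) % ℓ               ∎

    *-congₘ : ∀ {a b c d} → a ≡ₘ b → c ≡ₘ d → a * c ≡ₘ b * d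
    *-congₘ {a} {b} {c} {d} a≡b c≡d = begin
      (a * c) % ℓ               ≡⟨ %-distribˡ-* a c ℓ ⟩
      (a % ℓ * (c % ℓ)) % ℓ     ≡⟨ cong₂ (λ u v → (u * v) % ℓ) a≡b c≡d ⟩
      (b % ℓ * (d % ℓ)) % ℓ     ≡⟨ %-distribˡ-* b d ℓ ⟨
      (b * d) % ℓ               ∎

    +-*ℓ≡ₘ : ∀ a k → a + k * ℓ ≡ₘ a
    +-*ℓ≡ₘ a k = [m+kn]%n≡m%n a k ℓ

    ℓ≡ₘ0 : ℓ ≡ₘ 0
    ℓ≡ₘ0 = trans (cong (_% ℓ) (sym (ℕₚ.+-identityʳ ℓ))) (+-*ℓ≡ₘ 0 1)

    +-cancelʳₘ : ∀ a b x → a + x ≡ₘ b + x → a ≡ₘ b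
    +-cancelʳₘ a b x a+x≡b+x = begin
      a % ℓ                           ≡⟨ +-*ℓ≡ₘ a x ⟨
      (a + x * ℓ) % ℓ                 ≡⟨ cong (_% ℓ) (regroup a) ⟩
      ((a + x) + x * (ℓ ∸ 1)) % ℓ     ≡⟨ +-congₘ a+x≡b+x refl ⟩
      ((b + x) + x * (ℓ ∸ 1)) % ℓ     ≡⟨ cong (_% ℓ) (regroup b) ⟨
      (b + x * ℓ) % ℓ                 ≡⟨ +-*ℓ≡ₘ b x ⟩
      b % ℓ                           ∎
      where
      regroup : ∀ c → c + x * ℓ ≡ (c + x) + x * (ℓ ∸ 1)
      regroup c = begin
        c + x * ℓ                   ≡⟨ cong (λ t → c + x * t) (ℕₚ.m+[n∸m]≡n (>-nonZero⁻¹ ℓ)) ⟨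
        c + x * (1 + (ℓ ∸ 1))       ≡⟨ solve 3 (λ c x m → c :+ x :* (con 1 :+ m) := (c :+ x) :+ x :* m) refl c x (ℓ ∸ 1) ⟩
        (c + x) + x * (ℓ ∸ 1)       ∎

    ∣∸1⇒≡ₘ1 : ∀ {n} → 0 < n → ℓ ∣ n ∸ 1 → n ≡ₘ 1
    ∣∸1⇒≡ₘ1 {n} n>0 (divides k n∸1≡kℓ) = begin
      n % ℓ                 ≡⟨ cong (_% ℓ) (ℕₚ.m∸n+n≡m n>0) ⟨
      (n ∸ 1 + 1) % ℓ       ≡⟨ cong (λ t → (t + 1) % ℓ) n∸1≡kℓ ⟩
      (k * ℓ + 1) % ℓ       ≡⟨ cong (_% ℓ) (ℕₚ.+-comm (k * ℓ) 1) ⟩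
      (1 + k * ℓ) % ℓ       ≡⟨ +-*ℓ≡ₘ 1 k ⟩
      1 % ℓ                 ∎

    inverseₘ : ∀ {j} → Coprime j ℓ → ∃ λ u → u * j ≡ₘ 1
    inverseₘ {j} j⊥ℓ with coprime-Bézout j⊥ℓ
    ... | Bézout.+- x y 1+yℓ≡xj = x , (begin
      (x * j) % ℓ           ≡⟨ cong (_% ℓ) 1+yℓ≡xj ⟨
      (1 + y * ℓ) % ℓ       ≡⟨ +-*ℓ≡ₘ 1 y ⟩
      1 % ℓ                 ∎)
    ... | Bézout.-+ x y 1+xj≡yℓ = (ℓ ∸ 1) * x , +-cancelʳₘ _ 1 (ℓ ∸ 1) (begin
      ((ℓ ∸ 1) * x * j + (ℓ ∸ 1)) % ℓ   ≡⟨ cong (_% ℓ) (solve 3 (λ m x j → m :* x :* j :+ m := m :* (con 1 :+ x :* j)) refl (ℓ ∸ 1) x j) ⟩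
      ((ℓ ∸ 1) * (1 + x * j)) % ℓ       ≡⟨ cong (λ t → ((ℓ ∸ 1) * t) % ℓ) 1+xj≡yℓ ⟩
      ((ℓ ∸ 1) * (y * ℓ)) % ℓ           ≡⟨ cong (_% ℓ) (ℕₚ.*-assoc (ℓ ∸ 1) y ℓ) ⟨
      ((ℓ ∸ 1) * y * ℓ) % ℓ             ≡⟨ +-*ℓ≡ₘ 0 ((ℓ ∸ 1) * y) ⟩
      0 % ℓ                             ≡⟨ ℓ≡ₘ0 ⟨
      ℓ % ℓ                             ≡⟨ cong (_% ℓ) (ℕₚ.m+[n∸m]≡n (>-nonZero⁻¹ ℓ)) ⟨
      (1 + (ℓ ∸ 1)) % ℓ                 ∎)

    0%ℓ≡0 : 0 % ℓ ≡ 0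
    0%ℓ≡0 = m<n⇒m%n≡m (>-nonZero⁻¹ ℓ)

    ≡ₘ⇒≡ : ∀ {a b} → a < ℓ → b < ℓ → a ≡ₘ b → a ≡ b
    ≡ₘ⇒≡ a<ℓ b<ℓ a≡b = trans (sym (m<n⇒m%n≡m a<ℓ)) (trans a≡b (m<n⇒m%n≡m b<ℓ))

    coprime-*≡ₘ0 : ∀ {n a} → Coprime ℓ n → n * a ≡ₘ 0 → a ≡ₘ 0
    coprime-*≡ₘ0 {n} {a} ℓ⊥n na≡0 =
      trans (n∣m⇒m%n≡0 a ℓ (coprime-divisor ℓ⊥n (m%n≡0⇒n∣m (n * a) ℓ (trans na≡0 0%ℓ≡0)))) (sym 0%ℓ≡0)

    *-cancelʳₘ : ∀ {n t a b} → n * t ≡ₘ 1 → a * n ≡ₘ b * n → a ≡ₘ b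
    *-cancelʳₘ {n} {t} {a} {b} nt≡1 an≡bn = begin
      a % ℓ                ≡⟨ cong (_% ℓ) (ℕₚ.*-identityʳ a) ⟨
      (a * 1) % ℓ          ≡⟨ *-congₘ {a} refl nt≡1 ⟨
      (a * (n * t)) % ℓ    ≡⟨ cong (_% ℓ) (ℕₚ.*-assoc a n t) ⟨
      (a * n * t) % ℓ      ≡⟨ *-congₘ an≡bn refl ⟩
      (b * n * t) % ℓ      ≡⟨ cong (_% ℓ) (ℕₚ.*-assoc b n t) ⟩
      (b * (n * t)) % ℓ    ≡⟨ *-congₘ {b} refl nt≡1 ⟩
      (b * 1) % ℓ          ≡⟨ cong (_% ℓ) (ℕₚ.*-identityʳ b) ⟩
      b % ℓ                ∎

    [j+[ℓ∸i]]+i≡ₘj : ∀ {i} j → i ≤ ℓ → (j + (ℓ ∸ i)) + i ≡ₘ j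
    [j+[ℓ∸i]]+i≡ₘj {i} j i≤ℓ = begin
      ((j + (ℓ ∸ i)) + i) % ℓ     ≡⟨ cong (_% ℓ) (trans (ℕₚ.+-assoc j (ℓ ∸ i) i) (cong (j +_) (ℕₚ.m∸n+n≡m i≤ℓ))) ⟩
      (j + ℓ) % ℓ                 ≡⟨ cong (λ t → (j + t) % ℓ) (ℕₚ.+-identityʳ ℓ) ⟨
      (j + 1 * ℓ) % ℓ             ≡⟨ +-*ℓ≡ₘ j 1 ⟩
      j % ℓ                       ∎

    [ℓ∸1]*j+j≡ₘ0 : ∀ j → (ℓ ∸ 1) * j + j ≡ₘ 0
    [ℓ∸1]*j+j≡ₘ0 j = begin
      ((ℓ ∸ 1) * j + j) % ℓ         ≡⟨ cong (_% ℓ) (solve 2 (λ m j → m :* j :+ j := j :* (con 1 :+ m)) refl (ℓ ∸ 1) j) ⟩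
      (j * (1 + (ℓ ∸ 1))) % ℓ       ≡⟨ cong (λ t → (j * t) % ℓ) (ℕₚ.m+[n∸m]≡n (>-nonZero⁻¹ ℓ)) ⟩
      (j * ℓ) % ℓ                   ≡⟨ +-*ℓ≡ₘ 0 j ⟩
      0 % ℓ                         ∎

    solve-linearₘ : ∀ {j i} → Coprime j ℓ → i ≤ ℓ → ∃ λ m → m * j + i ≡ₘ 0
    solve-linearₘ {j} {i} j⊥ℓ i≤ℓ with u , uj≡1 ← inverseₘ j⊥ℓ = u * (ℓ ∸ i) , (begin
      (u * (ℓ ∸ i) * j + i) % ℓ     ≡⟨ cong (λ t → (t + i) % ℓ) (solve 3 (λ u m j → u :* m :* j := u :* j :* m) refl u (ℓ ∸ i) j) ⟩
      (u * j * (ℓ ∸ i) + i) % ℓ     ≡⟨ +-congₘ {b = 1 * (ℓ ∸ i)} (*-congₘ uj≡1 refl) refl ⟩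
      (1 * (ℓ ∸ i) + i) % ℓ         ≡⟨ cong (_% ℓ) (trans (cong (_+ i) (ℕₚ.*-identityˡ (ℓ ∸ i))) (ℕₚ.m∸n+n≡m i≤ℓ)) ⟩
      ℓ % ℓ                         ≡⟨ ℓ≡ₘ0 ⟩
      0 % ℓ                         ∎)

    -- i ≡ −m j, so i′ ≡ −m j′ ≡ −m j t ≡ i t.
    scale-solutionₘ : ∀ {m j i j′ i′ t} → m * j + i ≡ₘ 0 → m * j′ + i′ ≡ₘ 0 → j′ ≡ₘ j * t → i′ ≡ₘ i * t
    scale-solutionₘ {m} {j} {i} {j′} {i′} {t} mj+i≡0 mj′+i′≡0 j′≡jt = +-cancelʳₘ i′ (i * t) (m * j′) (begin
      (i′ + m * j′) % ℓ          ≡⟨ cong (_% ℓ) (ℕₚ.+-comm i′ (m * j′)) ⟩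
      (m * j′ + i′) % ℓ          ≡⟨ mj′+i′≡0 ⟩
      0 % ℓ                      ≡⟨ *-congₘ {0} {m * j + i} {t} (sym mj+i≡0) refl ⟩
      ((m * j + i) * t) % ℓ      ≡⟨ cong (_% ℓ) (solve 4 (λ m j i t → (m :* j :+ i) :* t := i :* t :+ m :* (j :* t)) refl m j i t) ⟩
      (i * t + m * (j * t)) % ℓ  ≡⟨ +-congₘ {i * t} refl (*-congₘ {m} refl (sym j′≡jt)) ⟩
      (i * t + m * j′) % ℓ       ∎)


applyUpTo-cong : ∀ {A : Set} {f g : ℕ → A} → (∀ k → f k ≡ g k) → ∀ n → applyUpTo f n ≡ applyUpTo g n
applyUpTo-cong f≗g zero    = refl
applyUpTo-cong f≗g (suc n) = cong₂ _∷_ (f≗g 0) (applyUpTo-cong (λ k → f≗g (suc k)) n)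

map≡self⇒All-fixed : ∀ {A : Set} (σ : A → A) xs → map σ xs ≡ xs → All (λ x → σ x ≡ x) xs
map≡self⇒All-fixed σ []       _     = []
map≡self⇒All-fixed σ (x ∷ xs) σxs≡xs = ∷-injectiveˡ σxs≡xs ∷ map≡self⇒All-fixed σ xs (∷-injectiveʳ σxs≡xs)

injective⇒surjective : ∀ {n} (f : Fin n → Fin n) → Injective _≡_ _≡_ f → ∀ y → ∃ λ x → f x ≡ y
injective⇒surjective {suc n} f f-inj y with Fin.any? (λ x → f x Fin.≟ y)
... | yes hit = hit
... | no miss = ⊥-elim (ℕₚ.<-irrefl refl (Fin.injective⇒≤ {f = f′} f′-inj))
  where
  y≢f : ∀ x → y ≢ f x
  y≢f x y≡fx = miss (x , sym y≡fx)
  f′ : Fin (suc n) → Fin n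
  f′ x = punchOut (y≢f x)
  f′-inj : Injective _≡_ _≡_ f′
  f′-inj f′x≡f′z = f-inj (Fin.punchOut-injective (y≢f _) (y≢f _) f′x≡f′z)

injective⇒↔ : ∀ {n} {X : Set} → Fin n ↔ X → (f : X → X) → Injective _≡_ _≡_ f → X ↔ X
injective⇒↔ {X = X} e f f-inj = mk↔ₛ′ f f⁻¹ (λ y → proj₂ (surjective y)) (λ x → f-inj (proj₂ (surjective (f x))))
  where
  open Inverse e using (to; from)
  to-inj : Injective _≡_ _≡_ to
  to-inj = Injection.injective (↔⇒↣ e)
  from-inj : Injective _≡_ _≡_ from
  from-inj = Injection.injective (↔⇒↣ (↔-sym e))
  surjective : ∀ y → ∃ λ x → f x ≡ y
  surjective y with i , eq ← injective⇒surjective (λ i → from (f (to i))) (λ eq → to-inj (f-inj (from-inj eq))) (from y)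
    = to i , from-inj eq
  f⁻¹ : X → X
  f⁻¹ y = proj₁ (surjective y)

module Intertwining {G : Set} (_·_ : G → G → G) (e : G)
                    (·-assoc : ∀ x y z → (x · y) · z ≡ x · (y · z)) (·-identityˡ : ∀ x → e · x ≡ x)
                    (·-cancelʳ : ∀ x y z → y · x ≡ z · x → y ≡ z) (φ : G → G) where

  Intertwines : G → G → Set
  Intertwines g s = ∀ x → φ (g · x) ≡ s · φ x

  intertwines-· : ∀ {g s g′ s′} → Intertwines g s → Intertwines g′ s′ → Intertwines (g · g′) (s · s′)
  intertwines-· {g} {s} {g′} {s′} φ-g φ-g′ x = begin
    φ ((g · g′) · x)      ≡⟨ cong φ (·-assoc g g′ x) ⟩
    φ (g · (g′ · x))      ≡⟨ φ-g (g′ · x) ⟩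
    s · φ (g′ · x)        ≡⟨ cong (s ·_) (φ-g′ x) ⟩
    s · (s′ · φ x)        ≡⟨ ·-assoc s s′ (φ x) ⟨
    (s · s′) · φ x        ∎

  intertwines-e : Intertwines e e
  intertwines-e x = trans (cong φ (·-identityˡ x)) (sym (·-identityˡ (φ x)))

  intertwines-unique : ∀ {g s s′} → Intertwines g s → Intertwines g s′ → s ≡ s′
  intertwines-unique φ-s φ-s′ = ·-cancelʳ (φ e) _ _ (trans (sym (φ-s e)) (φ-s′ e))

module FieldProperties {q : ℕ} (F : FiniteField q) where

  open FiniteField F public
  open IsCommutativeRing isCommutativeRing public
    using (+-assoc; +-comm; *-assoc; *-comm; +-identityˡ; +-identityʳ; *-identityˡ; *-identityʳ;
           distribˡ; distribʳ; zeroˡ; zeroʳ; -‿inverseˡ; -‿inverseʳ)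

  commutativeRing : CommutativeRing 0ℓ 0ℓ
  commutativeRing = record { isCommutativeRing = isCommutativeRing }

  open CommutativeRing commutativeRing using (ring; semiring; commutativeSemiring; +-group; +-commutativeMonoid)
  open import Algebra.Properties.Group +-group public
    using (//-rightDividesˡ; //-rightDividesʳ; x∙y⁻¹≈ε⇒x≈y; inverseˡ-unique)
    renaming (∙-cancelˡ to +-cancelˡ; ∙-cancelʳ to +-cancelʳ)
  open import Algebra.Properties.Ring ring public using (-‿distribʳ-*; x+x≈x⇒x≈0)
  open import Algebra.Properties.Semiring.Mult semiring public using (×-homo-+; ×1-homo-*; ×-assoc-*) renaming (_×_ to _×ₙ_)
  open import Algebra.Properties.Semiring.Exp semiring using () renaming (_^_ to _^ₛ_; ^-homo-* to ^ₛ-homo-*; ^-assocʳ to ^ₛ-assocʳ)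
  open import Algebra.Properties.CommutativeSemiring.Exp commutativeSemiring using () renaming (^-distrib-* to ^ₛ-distrib-*)
  open import Algebra.Properties.CommutativeMonoid.Sum +-commutativeMonoid
    using (sum; sum-cong-≗; sum-permute; ∑-distrib-+; sum-replicate; sum-replicate-zero; sum-init-last)
  open import Algebra.Properties.CommutativeSemiring.Binomial commutativeSemiring using (binomialTerm) renaming (theorem to binomialTheorem)
  open import Algebra.Solver.Ring.NaturalCoefficients.Default commutativeSemiring public using (solve; _:=_; _:+_; _:*_; con)

  _≟_ : DecidableEquality Carrier
  x ≟ y = Dec.map′ (Injection.injective (↔⇒↣ (↔-sym enumeration))) (cong (Inverse.from enumeration))
                   (Inverse.from enumeration x Fin.≟ Inverse.from enumeration y)

  *-cancelʳ : ∀ {x y z} → z ≢ 0F → x * z ≡ y * z → x ≡ y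
  *-cancelʳ {x} {y} {z} z≢0 xz≡yz = trans (divide x) (trans (cong (_* z⁻¹) xz≡yz) (sym (divide y)))
    where
    z⁻¹ = proj₁ (inverse z z≢0)
    divide : ∀ u → u ≡ u * z * z⁻¹
    divide u = begin
      u                ≡⟨ *-identityʳ u ⟨
      u * 1F           ≡⟨ cong (u *_) (proj₂ (inverse z z≢0)) ⟨
      u * (z * z⁻¹)    ≡⟨ *-assoc u z z⁻¹ ⟨
      u * z * z⁻¹      ∎

  *-cancelˡ : ∀ {x y z} → x ≢ 0F → x * y ≡ x * z → y ≡ z
  *-cancelˡ {x} {y} {z} x≢0 xy≡xz = *-cancelʳ x≢0 (trans (*-comm y x) (trans xy≡xz (*-comm x z)))

  x*y≡0⇒x≡0⊎y≡0 : ∀ {x y} → x * y ≡ 0F → x ≡ 0F ⊎ y ≡ 0F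
  x*y≡0⇒x≡0⊎y≡0 {x} {y} xy≡0 with y ≟ 0F
  ... | yes y≡0 = inj₂ y≡0
  ... | no  y≢0 = inj₁ (*-cancelʳ y≢0 (trans xy≡0 (sym (zeroˡ y))))

  ^≡^ₛ : ∀ x n → x ^ n ≡ x ^ₛ n
  ^≡^ₛ x zero    = refl
  ^≡^ₛ x (suc n) = cong (x *_) (^≡^ₛ x n)

  ^-homo-* : ∀ x m n → x ^ (m ℕ.+ n) ≡ x ^ m * x ^ n
  ^-homo-* x m n rewrite ^≡^ₛ x (m ℕ.+ n) | ^≡^ₛ x m | ^≡^ₛ x n = ^ₛ-homo-* x m n

  ^-assocʳ : ∀ x m n → (x ^ m) ^ n ≡ x ^ (m ℕ.* n)
  ^-assocʳ x m n rewrite ^≡^ₛ (x ^ m) n | ^≡^ₛ x m | ^≡^ₛ x (m ℕ.* n) = ^ₛ-assocʳ x m n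

  ^-distrib-* : ∀ x y n → (x * y) ^ n ≡ x ^ n * y ^ n
  ^-distrib-* x y n rewrite ^≡^ₛ (x * y) n | ^≡^ₛ x n | ^≡^ₛ y n = ^ₛ-distrib-* x y n

  ^≢0 : ∀ {x} n → x ≢ 0F → x ^ n ≢ 0F
  ^≢0 zero    x≢0 1≡0 = 0≢1 (sym 1≡0)
  ^≢0 (suc n) x≢0 xxⁿ≡0 with x*y≡0⇒x≡0⊎y≡0 xxⁿ≡0
  ... | inj₁ x≡0  = x≢0 x≡0
  ... | inj₂ xⁿ≡0 = ^≢0 n x≢0 xⁿ≡0

  ^≡0⇒≡0 : ∀ {x} n → x ^ n ≡ 0F → x ≡ 0F
  ^≡0⇒≡0 {x} n xⁿ≡0 with x ≟ 0F
  ... | yes x≡0 = x≡0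
  ... | no  x≢0 = ⊥-elim (^≢0 n x≢0 xⁿ≡0)

  0^n≡0 : ∀ n .{{_ : NonZero n}} → 0F ^ n ≡ 0F
  0^n≡0 (suc n) = zeroˡ _

  1^n≡1 : ∀ n → 1F ^ n ≡ 1F
  1^n≡1 zero    = refl
  1^n≡1 (suc n) = trans (*-identityˡ _) (1^n≡1 n)

  +1↔ : Carrier ↔ Carrier
  +1↔ = mk↔ₛ′ (_+ 1F) (_+ - 1F) (//-rightDividesˡ 1F) (//-rightDividesʳ 1F)

  -- The sum of all elements is unchanged by the translation x ↦ x + 1, which adds q · 1 to it.
  q×1≡0 : q ×ₙ 1F ≡ 0F
  q×1≡0 = +-cancelˡ (sum x) (q ×ₙ 1F) 0F (begin
    sum x + q ×ₙ 1F                  ≡⟨ cong (sum x +_) (sum-replicate q) ⟨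
    sum x + sum {q} (λ _ → 1F)       ≡⟨ ∑-distrib-+ x (λ _ → 1F) ⟨
    sum (λ i → x i + 1F)             ≡⟨ sum-cong-≗ (λ i → Inverse.strictlyInverseˡ enumeration (x i + 1F)) ⟨
    sum (rearrange (π ⟨$⟩ʳ_) x)      ≡⟨ sum-permute x π ⟨
    sum x                            ≡⟨ +-identityʳ (sum x) ⟨
    sum x + 0F                       ∎)
    where
    x : Fin q → Carrier
    x = Inverse.to enumeration
    π : Permutation q q
    π = ↔-sym enumeration ↔-∘ (+1↔ ↔-∘ enumeration)

  ^-distrib-+ : ∀ n → (∀ k z → 0 < k → k < suc n → (suc n C k) ×ₙ z ≡ 0F) →
                ∀ x y → (x + y) ^ suc n ≡ x ^ suc n + y ^ suc n
  ^-distrib-+ n inner≡0 x y = begin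
    (x + y) ^ suc n                                               ≡⟨ ^≡^ₛ (x + y) (suc n) ⟩
    (x + y) ^ₛ suc n                                              ≡⟨ binomialTheorem (suc n) x y ⟩
    t Fin.zero + sum (tail t)                                     ≡⟨ cong (t Fin.zero +_) (sum-init-last (tail t)) ⟩
    t Fin.zero + (sum (init (tail t)) + term (suc (toℕ (fromℕ n))))
      ≡⟨ cong₂ (λ s k → t Fin.zero + (s + term (suc k))) (trans (sum-cong-≗ middle≡0) (sum-replicate-zero n)) (Fin.toℕ-fromℕ n) ⟩
    t Fin.zero + (0F + term (suc n))                              ≡⟨ cong₂ (λ a b → a + (0F + b)) first≡ last≡ ⟩
    y ^ suc n + (0F + x ^ suc n)                                  ≡⟨ trans (cong (y ^ suc n +_) (+-identityˡ _)) (+-comm _ _) ⟩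
    x ^ suc n + y ^ suc n                                         ∎
    where
    t : Fin (suc (suc n)) → Carrier
    t = binomialTerm x y (suc n)
    term : ℕ → Carrier
    term k = (suc n C k) ×ₙ (x ^ₛ k * y ^ₛ (suc n ∸ k))
    middle≡0 : ∀ i → init (tail t) i ≡ 0F
    middle≡0 i = inner≡0 (suc (toℕ (Fin.inject₁ i))) _ (s≤s z≤n) (s≤s (Fin.inject₁ℕ< i))
    first≡ : t Fin.zero ≡ y ^ suc n
    first≡ = trans (+-identityʳ _) (trans (*-identityˡ _) (sym (^≡^ₛ y (suc n))))
    last≡ : term (suc n) ≡ x ^ suc n
    last≡ = begin
      term (suc n)                       ≡⟨ cong₂ (λ c e → c ×ₙ (x ^ₛ suc n * y ^ₛ e)) (nCn≡1 (suc n)) (ℕₚ.n∸n≡0 n) ⟩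
      x ^ₛ suc n * 1F + 0F               ≡⟨ trans (+-identityʳ _) (*-identityʳ _) ⟩
      x ^ₛ suc n                         ≡⟨ ^≡^ₛ x (suc n) ⟨
      x ^ suc n                          ∎

  -- The monic polynomial xⁿ + aₙ₋₁xⁿ⁻¹ + ⋯ + a₀ is represented by [a₀, …, aₙ₋₁], so length is degree.
  evalMonic : List Carrier → Carrier → Carrier
  evalMonic []       x = 1F
  evalMonic (a ∷ as) x = a + x * evalMonic as x

  evalMonic-replicate-0 : ∀ n x → evalMonic (replicate n 0F) x ≡ x ^ n
  evalMonic-replicate-0 zero    x = refl
  evalMonic-replicate-0 (suc n) x = trans (+-identityˡ _) (cong (x *_) (evalMonic-replicate-0 n x))

  -- f(x) − f(r) = (x − r) g(x), with both sides moved so that no subtraction occurs.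
  remainder-theorem : ∀ a as r → ∃ λ bs → length bs ≡ length as ×
                        (∀ x → evalMonic (a ∷ as) x + r * evalMonic bs x ≡ x * evalMonic bs x + evalMonic (a ∷ as) r)
  remainder-theorem a [] r =
    [] , refl , λ x → solve 4 (λ a x r o → (a :+ x :* o) :+ r :* o := x :* o :+ (a :+ r :* o)) refl a x r 1F
  remainder-theorem a (a′ ∷ as) r with remainder-theorem a′ as r
  ... | bs , |bs|≡|as| , division = evalMonic (a′ ∷ as) r ∷ bs , cong suc |bs|≡|as| , λ x → begin
    a + x * f x + r * (f r + x * g x)
      ≡⟨ solve 6 (λ a x r f g fr → a :+ x :* f :+ r :* (fr :+ x :* g) := a :+ r :* fr :+ x :* (f :+ r :* g)) refl a x r (f x) (g x) (f r) ⟩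
    a + r * f r + x * (f x + r * g x)        ≡⟨ cong (λ t → a + r * f r + x * t) (division x) ⟩
    a + r * f r + x * (x * g x + f r)
      ≡⟨ solve 5 (λ a x r g fr → a :+ r :* fr :+ x :* (x :* g :+ fr) := x :* (fr :+ x :* g) :+ (a :+ r :* fr)) refl a x r (g x) (f r) ⟩
    x * (f r + x * g x) + (a + r * f r)      ∎
    where
    f g : Carrier → Carrier
    f = evalMonic (a′ ∷ as)
    g = evalMonic bs

  roots≤degree : ∀ as rs → AllPairs _≢_ rs → All (λ r → evalMonic as r ≡ 0F) rs → length rs ≤ length as
  roots≤degree as       []       _                  _          = z≤n
  roots≤degree []       (r ∷ rs) _                  (1≡0 ∷ _)  = ⊥-elim (0≢1 (sym 1≡0))
  roots≤degree (a ∷ as) (r ∷ rs) (r∉rs ∷ rs-distinct) (fr≡0 ∷ frs≡0) with remainder-theorem a as r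
  ... | bs , |bs|≡|as| , division =
    s≤s (subst (length rs ≤_) |bs|≡|as| (roots≤degree bs rs rs-distinct (All.zipWith root-of-quotient (r∉rs , frs≡0))))
    where
    root-of-quotient : ∀ {u} → r ≢ u × evalMonic (a ∷ as) u ≡ 0F → evalMonic bs u ≡ 0F
    root-of-quotient {u} (r≢u , fu≡0) with evalMonic bs u ≟ 0F
    ... | yes gu≡0 = gu≡0
    ... | no  gu≢0 = ⊥-elim (r≢u (*-cancelʳ gu≢0 (begin
      r * evalMonic bs u                            ≡⟨ +-identityˡ _ ⟨
      0F + r * evalMonic bs u                       ≡⟨ cong (λ t → t + r * evalMonic bs u) fu≡0 ⟨
      evalMonic (a ∷ as) u + r * evalMonic bs u     ≡⟨ division u ⟩
      u * evalMonic bs u + evalMonic (a ∷ as) r     ≡⟨ cong (u * evalMonic bs u +_) fr≡0 ⟩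
      u * evalMonic bs u + 0F                       ≡⟨ +-identityʳ _ ⟩
      u * evalMonic bs u                            ∎)))

  -- mulLinear′ c P as represents (x + c) · f(x) + P, where as represents f.
  mulLinear′ : Carrier → Carrier → List Carrier → List Carrier
  mulLinear′ c P []       = (P + c) ∷ []
  mulLinear′ c P (a ∷ as) = (P + c * a) ∷ mulLinear′ c a as

  mulLinear : Carrier → List Carrier → List Carrier
  mulLinear c = mulLinear′ c 0F

  ∏Linear : List Carrier → List Carrier
  ∏Linear []       = []
  ∏Linear (c ∷ cs) = mulLinear c (∏Linear cs)

  evalMonic-mulLinear′ : ∀ c P as x → evalMonic (mulLinear′ c P as) x ≡ (x + c) * evalMonic as x + P
  evalMonic-mulLinear′ c P []       x = solve 3 (λ c P x → (P :+ c) :+ x :* con 1 := (x :+ c) :* con 1 :+ P) refl c P x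
  evalMonic-mulLinear′ c P (a ∷ as) x = begin
    (P + c * a) + x * evalMonic (mulLinear′ c a as) x    ≡⟨ cong (λ t → (P + c * a) + x * t) (evalMonic-mulLinear′ c a as x) ⟩
    (P + c * a) + x * ((x + c) * evalMonic as x + a)
      ≡⟨ solve 5 (λ c P x a f → (P :+ c :* a) :+ x :* ((x :+ c) :* f :+ a) := (x :+ c) :* (a :+ x :* f) :+ P) refl c P x a (evalMonic as x) ⟩
    (x + c) * (a + x * evalMonic as x) + P              ∎

  evalMonic-mulLinear : ∀ c as x → evalMonic (mulLinear c as) x ≡ (x + c) * evalMonic as x
  evalMonic-mulLinear c as x = trans (evalMonic-mulLinear′ c 0F as x) (+-identityʳ _)

  mulLinear′-comm : ∀ b c P Q as → mulLinear′ b (Q + c * P) (mulLinear′ c P as) ≡ mulLinear′ c (Q + b * P) (mulLinear′ b P as)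
  mulLinear′-comm b c P Q [] = cong₂ _∷_
    (solve 4 (λ b c P Q → (Q :+ c :* P) :+ b :* (P :+ c) := (Q :+ b :* P) :+ c :* (P :+ b)) refl b c P Q)
    (cong [_] (solve 3 (λ b c P → (P :+ c) :+ b := (P :+ b) :+ c) refl b c P))
  mulLinear′-comm b c P Q (a ∷ as) = cong₂ _∷_
    (solve 5 (λ b c P Q a → (Q :+ c :* P) :+ b :* (P :+ c :* a) := (Q :+ b :* P) :+ c :* (P :+ b :* a)) refl b c P Q a)
    (mulLinear′-comm b c a P as)

  mulLinear-comm : ∀ b c as → mulLinear b (mulLinear c as) ≡ mulLinear c (mulLinear b as)
  mulLinear-comm b c as = begin
    mulLinear′ b 0F (mulLinear′ c 0F as)              ≡⟨ cong (λ Q → mulLinear′ b Q (mulLinear′ c 0F as)) (0≡0+x*0 c) ⟩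
    mulLinear′ b (0F + c * 0F) (mulLinear′ c 0F as)   ≡⟨ mulLinear′-comm b c 0F 0F as ⟩
    mulLinear′ c (0F + b * 0F) (mulLinear′ b 0F as)   ≡⟨ cong (λ Q → mulLinear′ c Q (mulLinear′ b 0F as)) (0≡0+x*0 b) ⟨
    mulLinear′ c 0F (mulLinear′ b 0F as)              ∎
    where
    0≡0+x*0 : ∀ x → 0F ≡ 0F + x * 0F
    0≡0+x*0 x = sym (trans (+-identityˡ _) (zeroʳ x))

  ∏Linear-∷ʳ : ∀ cs c → ∏Linear (cs ∷ʳ c) ≡ ∏Linear (c ∷ cs)
  ∏Linear-∷ʳ []       c = refl
  ∏Linear-∷ʳ (b ∷ cs) c = trans (cong (mulLinear b) (∏Linear-∷ʳ cs c)) (mulLinear-comm b c (∏Linear cs))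

  ∏Linear-root⁻ : ∀ cs {x} → evalMonic (∏Linear cs) x ≡ 0F → Any (λ c → x + c ≡ 0F) cs
  ∏Linear-root⁻ []       1≡0 = ⊥-elim (0≢1 (sym 1≡0))
  ∏Linear-root⁻ (c ∷ cs) {x} f≡0 with x*y≡0⇒x≡0⊎y≡0 (trans (sym (evalMonic-mulLinear c (∏Linear cs) x)) f≡0)
  ... | inj₁ x+c≡0 = here x+c≡0
  ... | inj₂ g≡0   = there (∏Linear-root⁻ cs g≡0)

  module _ (σ : Carrier → Carrier) (σ-+ : ∀ x y → σ (x + y) ≡ σ x + σ y) (σ-* : ∀ x y → σ (x * y) ≡ σ x * σ y) where

    map-mulLinear′ : ∀ c P as → map σ (mulLinear′ c P as) ≡ mulLinear′ (σ c) (σ P) (map σ as)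
    map-mulLinear′ c P []       = cong [_] (σ-+ P c)
    map-mulLinear′ c P (a ∷ as) = cong₂ _∷_ (trans (σ-+ P (c * a)) (cong (σ P +_) (σ-* c a))) (map-mulLinear′ c a as)

    map-∏Linear : ∀ cs → map σ (∏Linear cs) ≡ ∏Linear (map σ cs)
    map-∏Linear []       = refl
    map-∏Linear (c ∷ cs) = trans (map-mulLinear′ c 0F (∏Linear cs)) (cong₂ (mulLinear′ (σ c)) σ0≡0 (map-∏Linear cs))
      where
      σ0≡0 : σ 0F ≡ 0F
      σ0≡0 = x+x≈x⇒x≈0 (σ 0F) (trans (sym (σ-+ 0F 0F)) (cong σ (+-identityˡ 0F)))

module Frobenius {p d : ℕ} (p-prime : Prime p) (F : FiniteField (p ℕ.^ d)) where

  open FieldProperties F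

  instance
    p-nonZero : NonZero p
    p-nonZero = prime⇒nonZero p-prime

  ×1-homo-^ : ∀ m n → (m ℕ.^ n) ×ₙ 1F ≡ (m ×ₙ 1F) ^ n
  ×1-homo-^ m zero    = +-identityʳ 1F
  ×1-homo-^ m (suc n) = trans (×1-homo-* m (m ℕ.^ n)) (cong (m ×ₙ 1F *_) (×1-homo-^ m n))

  p×1≡0 : p ×ₙ 1F ≡ 0F
  p×1≡0 = ^≡0⇒≡0 d (trans (sym (×1-homo-^ p d)) q×1≡0)

  [m*p]×x≡0 : ∀ m x → (m ℕ.* p) ×ₙ x ≡ 0F
  [m*p]×x≡0 m x = begin
    (m ℕ.* p) ×ₙ x                  ≡⟨ cong ((m ℕ.* p) ×ₙ_) (*-identityˡ x) ⟨
    (m ℕ.* p) ×ₙ (1F * x)           ≡⟨ ×-assoc-* (m ℕ.* p) 1F x ⟨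
    (m ℕ.* p) ×ₙ 1F * x             ≡⟨ cong (_* x) (×1-homo-* m p) ⟩
    m ×ₙ 1F * p ×ₙ 1F * x           ≡⟨ cong (λ t → m ×ₙ 1F * t * x) p×1≡0 ⟩
    m ×ₙ 1F * 0F * x                ≡⟨ trans (cong (_* x) (zeroʳ _)) (zeroˡ x) ⟩
    0F                              ∎

  p×x≡0 : ∀ x → p ×ₙ x ≡ 0F
  p×x≡0 x = trans (cong (_×ₙ x) (sym (ℕₚ.*-identityˡ p))) ([m*p]×x≡0 1 x)

  frobenius-+ : ∀ x y → (x + y) ^ p ≡ x ^ p + y ^ p
  frobenius-+ x y = subst (λ n → (x + y) ^ n ≡ x ^ n + y ^ n) (ℕₚ.suc-pred p) (^-distrib-+ (ℕ.pred p) inner≡0 x y)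
    where
    inner≡0 : ∀ k z → 0 < k → k < suc (ℕ.pred p) → (suc (ℕ.pred p) C k) ×ₙ z ≡ 0F
    inner≡0 k z 0<k k<p with divides m pCk≡m*p ← prime∣pCk p-prime 0<k (subst (k <_) (ℕₚ.suc-pred p) k<p) =
      trans (cong (λ n → (n C k) ×ₙ z) (ℕₚ.suc-pred p)) (trans (cong (_×ₙ z) pCk≡m*p) ([m*p]×x≡0 m z))

  frobenius-‿ : ∀ x → (- x) ^ p ≡ - (x ^ p)
  frobenius-‿ x = inverseˡ-unique ((- x) ^ p) (x ^ p)
    (trans (sym (frobenius-+ (- x) x)) (trans (cong (_^ p) (-‿inverseˡ x)) (0^n≡0 p)))

  ×1-fixed : ∀ n → (n ×ₙ 1F) ^ p ≡ n ×ₙ 1F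
  ×1-fixed zero    = 0^n≡0 p
  ×1-fixed (suc n) = trans (frobenius-+ 1F (n ×ₙ 1F)) (cong₂ _+_ (1^n≡1 p) (×1-fixed n))

  frob : ℕ → Carrier → Carrier
  frob k x = x ^ (p ℕ.^ k)

  frob-zero : ∀ x → frob 0 x ≡ x
  frob-zero = *-identityʳ

  frob-suc : ∀ k x → frob (suc k) x ≡ frob k x ^ p
  frob-suc k x = trans (cong (x ^_) (ℕₚ.*-comm p (p ℕ.^ k))) (sym (^-assocʳ x (p ℕ.^ k) p))

  frob-+ : ∀ k x y → frob k (x + y) ≡ frob k x + frob k y
  frob-+ zero    x y = trans (frob-zero _) (sym (cong₂ _+_ (frob-zero x) (frob-zero y)))
  frob-+ (suc k) x y = begin
    frob (suc k) (x + y)                  ≡⟨ frob-suc k (x + y) ⟩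
    frob k (x + y) ^ p                    ≡⟨ cong (_^ p) (frob-+ k x y) ⟩
    (frob k x + frob k y) ^ p             ≡⟨ frobenius-+ (frob k x) (frob k y) ⟩
    frob k x ^ p + frob k y ^ p           ≡⟨ cong₂ _+_ (frob-suc k x) (frob-suc k y) ⟨
    frob (suc k) x + frob (suc k) y       ∎

  frob-* : ∀ k x y → frob k (x * y) ≡ frob k x * frob k y
  frob-* k x y = ^-distrib-* x y (p ℕ.^ k)

  frob-‿ : ∀ k x → frob k (- x) ≡ - frob k x
  frob-‿ zero    x = trans (frob-zero (- x)) (cong -_ (sym (frob-zero x)))
  frob-‿ (suc k) x = begin
    frob (suc k) (- x)      ≡⟨ frob-suc k (- x) ⟩
    frob k (- x) ^ p        ≡⟨ cong (_^ p) (frob-‿ k x) ⟩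
    (- frob k x) ^ p        ≡⟨ frobenius-‿ (frob k x) ⟩
    - (frob k x ^ p)        ≡⟨ cong -_ (frob-suc k x) ⟨
    - frob (suc k) x        ∎

  frob-injective : ∀ k {x y} → frob k x ≡ frob k y → x ≡ y
  frob-injective k {x} {y} fx≡fy = x∙y⁻¹≈ε⇒x≈y x y (^≡0⇒≡0 (p ℕ.^ k) (begin
    frob k (x + - y)          ≡⟨ frob-+ k x (- y) ⟩
    frob k x + frob k (- y)   ≡⟨ cong (frob k x +_) (frob-‿ k y) ⟩
    frob k x + - frob k y     ≡⟨ cong (_+ - frob k y) fx≡fy ⟩
    frob k y + - frob k y     ≡⟨ -‿inverseʳ (frob k y) ⟩
    0F                        ∎))

  1+a*b≢c*e : ∀ a b c e → b ×ₙ 1F ≡ 0F → e ×ₙ 1F ≡ 0F → 1 ℕ.+ a ℕ.* b ≢ c ℕ.* e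
  1+a*b≢c*e a b c e b≡0 e≡0 eq = 0≢1 (sym (begin
    1F                                  ≡⟨ +-identityʳ 1F ⟨
    1F + 0F                             ≡⟨ cong (1F +_) (trans (cong (a ×ₙ 1F *_) b≡0) (zeroʳ _)) ⟨
    1F + a ×ₙ 1F * b ×ₙ 1F              ≡⟨ cong (1F +_) (×1-homo-* a b) ⟨
    (1 ℕ.+ a ℕ.* b) ×ₙ 1F               ≡⟨ cong (_×ₙ 1F) eq ⟩
    (c ℕ.* e) ×ₙ 1F                     ≡⟨ ×1-homo-* c e ⟩
    c ×ₙ 1F * e ×ₙ 1F                   ≡⟨ trans (cong (c ×ₙ 1F *_) e≡0) (zeroʳ _) ⟩
    0F                                  ∎))

  ×1≢0 : ∀ {k} → 0 < k → k < p → k ×ₙ 1F ≢ 0F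
  ×1≢0 {k} 0<k k<p k×1≡0 with coprime-Bézout (prime⇒coprime p-prime {{ℕ.>-nonZero 0<k}} k<p)
  ... | Bézout.+- a b 1+bk≡ap = 1+a*b≢c*e b k a p k×1≡0 p×1≡0 1+bk≡ap
  ... | Bézout.-+ a b 1+ap≡bk = 1+a*b≢c*e a p b k p×1≡0 k×1≡0 1+ap≡bk

  ×1-injective : ∀ {m n} → m < n → n < p → m ×ₙ 1F ≢ n ×ₙ 1F
  ×1-injective {m} {n} m<n n<p m×1≡n×1 = ×1≢0 (ℕₚ.m<n⇒0<n∸m m<n) (ℕₚ.≤-<-trans (ℕₚ.m∸n≤m n m) n<p)
    (+-cancelˡ (m ×ₙ 1F) _ _ (begin
      m ×ₙ 1F + (n ∸ m) ×ₙ 1F     ≡⟨ ×-homo-+ 1F m (n ∸ m) ⟨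
      (m ℕ.+ (n ∸ m)) ×ₙ 1F       ≡⟨ cong (_×ₙ 1F) (ℕₚ.m+[n∸m]≡n (ℕₚ.<⇒≤ m<n)) ⟩
      n ×ₙ 1F                     ≡⟨ trans (sym m×1≡n×1) (sym (+-identityʳ _)) ⟩
      m ×ₙ 1F + 0F                ∎))

  𝔽ₚ : List Carrier
  𝔽ₚ = applyUpTo (_×ₙ 1F) p

  -- The p elements n · 1 (n < p) are roots of xᵖ − x, which has no room for another root.
  fixed⇒∈𝔽ₚ : ∀ x → x ^ p ≡ x → ∃ λ n → x ≡ n ×ₙ 1F
  fixed⇒∈𝔽ₚ x x^p≡x with Any.any? (x ≟_) 𝔽ₚ
  ... | yes x∈𝔽ₚ = let n , _ , x≡n×1 = Anyₚ.applyUpTo⁻ (_×ₙ 1F) x∈𝔽ₚ in n , x≡n×1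
  ... | no  x∉𝔽ₚ = ⊥-elim (ℕₚ.<-irrefl refl (subst₂ _≤_ (cong suc (length-applyUpTo _ p)) |xᵖ-x|≡p too-many-roots))
    where
    2+[p∸2]≡p : 2 ℕ.+ (p ∸ 2) ≡ p
    2+[p∸2]≡p = ℕₚ.m+[n∸m]≡n (ℕ.nonTrivial⇒n>1 p {{prime⇒nonTrivial p-prime}})
    xᵖ-x : List Carrier
    xᵖ-x = 0F ∷ - 1F ∷ replicate (p ∸ 2) 0F
    |xᵖ-x|≡p : length xᵖ-x ≡ p
    |xᵖ-x|≡p = trans (cong (λ n → 2 ℕ.+ n) (length-replicate (p ∸ 2))) 2+[p∸2]≡p
    root : ∀ y → y ^ p ≡ y → evalMonic xᵖ-x y ≡ 0F
    root y y^p≡y = begin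
      0F + y * (- 1F + y * evalMonic (replicate (p ∸ 2) 0F) y)  ≡⟨ +-identityˡ _ ⟩
      y * (- 1F + y * evalMonic (replicate (p ∸ 2) 0F) y)       ≡⟨ cong (λ t → y * (- 1F + y * t)) (evalMonic-replicate-0 (p ∸ 2) y) ⟩
      y * (- 1F + y ^ suc (p ∸ 2))                               ≡⟨ distribˡ y (- 1F) _ ⟩
      y * - 1F + y ^ (2 ℕ.+ (p ∸ 2))                             ≡⟨ cong₂ _+_ (trans (sym (-‿distribʳ-* y 1F)) (cong -_ (*-identityʳ y)))
                                                                           (trans (cong (y ^_) 2+[p∸2]≡p) y^p≡y) ⟩
      - y + y                                                    ≡⟨ -‿inverseˡ y ⟩
      0F                                                         ∎
    too-many-roots : length (x ∷ 𝔽ₚ) ≤ length xᵖ-x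
    too-many-roots = roots≤degree xᵖ-x (x ∷ 𝔽ₚ)
      (Allₚ.¬Any⇒All¬ 𝔽ₚ x∉𝔽ₚ ∷ AllPairsₚ.applyUpTo⁺₁ _ p ×1-injective)
      (root x x^p≡x ∷ Allₚ.applyUpTo⁺₂ _ p (λ n → root (n ×ₙ 1F) (×1-fixed n)))

  conjugatePolynomial : ℕ → Carrier → List Carrier
  conjugatePolynomial n ζ = ∏Linear (applyUpTo (λ k → - frob k ζ) n)

  conjugatePolynomial-∈𝔽ₚ : ∀ n ζ → frob (suc n) ζ ≡ ζ → All (λ a → ∃ λ m → a ≡ m ×ₙ 1F) (conjugatePolynomial (suc n) ζ)
  conjugatePolynomial-∈𝔽ₚ n ζ frob-fixed = All.map (fixed⇒∈𝔽ₚ _) (map≡self⇒All-fixed (_^ p) _ (begin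
    map (_^ p) (∏Linear cs)                       ≡⟨ map-∏Linear (_^ p) frobenius-+ (λ x y → ^-distrib-* x y p) cs ⟩
    ∏Linear (map (_^ p) cs)                       ≡⟨ cong ∏Linear rotated ⟩
    ∏Linear (applyUpTo (c ∘ suc) n ∷ʳ c 0)        ≡⟨ ∏Linear-∷ʳ (applyUpTo (c ∘ suc) n) (c 0) ⟩
    ∏Linear cs                                    ∎))
    where
    c : ℕ → Carrier
    c k = - frob k ζ
    cs : List Carrier
    cs = applyUpTo c (suc n)
    c-frob : ∀ k → c k ^ p ≡ c (suc k)
    c-frob k = trans (frobenius-‿ (frob k ζ)) (cong -_ (sym (frob-suc k ζ)))
    rotated : map (_^ p) cs ≡ applyUpTo (c ∘ suc) n ∷ʳ c 0
    rotated = begin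
      map (_^ p) cs                              ≡⟨ map-applyUpTo c (_^ p) (suc n) ⟩
      applyUpTo (λ k → c k ^ p) (suc n)          ≡⟨ applyUpTo-cong c-frob (suc n) ⟩
      applyUpTo (c ∘ suc) (suc n)                ≡⟨ applyUpTo-∷ʳ (c ∘ suc) n ⟨
      applyUpTo (c ∘ suc) n ∷ʳ c (suc n)         ≡⟨ cong (λ t → applyUpTo (c ∘ suc) n ∷ʳ - t) (trans frob-fixed (sym (frob-zero ζ))) ⟩
      applyUpTo (c ∘ suc) n ∷ʳ c 0               ∎

  conjugatePolynomial-root : ∀ n ζ → evalMonic (conjugatePolynomial (suc n) ζ) ζ ≡ 0F
  conjugatePolynomial-root n ζ = begin
    evalMonic (conjugatePolynomial (suc n) ζ) ζ      ≡⟨ evalMonic-mulLinear (- frob 0 ζ) others ζ ⟩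
    (ζ + - frob 0 ζ) * evalMonic others ζ            ≡⟨ cong (λ t → (ζ + - t) * evalMonic others ζ) (frob-zero ζ) ⟩
    (ζ + - ζ) * evalMonic others ζ                   ≡⟨ trans (cong (_* evalMonic others ζ) (-‿inverseʳ ζ)) (zeroˡ _) ⟩
    0F                                               ∎
    where
    others : List Carrier
    others = ∏Linear (applyUpTo (λ k → - frob (suc k) ζ) n)

  conjugatePolynomial-root⁻ : ∀ n ζ {x} → evalMonic (conjugatePolynomial n ζ) x ≡ 0F → ∃ λ k → k < n × x ≡ frob k ζ
  conjugatePolynomial-root⁻ n ζ {x} fx≡0 =
    let k , k<n , x-ζᵏ≡0 = Anyₚ.applyUpTo⁻ _ (∏Linear-root⁻ _ fx≡0) in k , k<n , x∙y⁻¹≈ε⇒x≈y x _ x-ζᵏ≡0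

module ElementOfOrder {q : ℕ} (F : FiniteField q) (ℓ : ℕ) .{{_ : NonZero ℓ}}
                      (h : FiniteField.Carrier F) (h-order : FiniteField.HasOrder F h ℓ) where

  open FieldProperties F
  open Modular ℓ

  h≢0 : h ≢ 0F
  h≢0 h≡0 = 0≢1 (begin
    0F        ≡⟨ 0^n≡0 ℓ ⟨
    0F ^ ℓ    ≡⟨ cong (_^ ℓ) h≡0 ⟨
    h ^ ℓ     ≡⟨ proj₁ h-order ⟩
    1F        ∎)

  h^-%ℓ : ∀ a → h ^ (a % ℓ) ≡ h ^ a
  h^-%ℓ a = sym (begin
    h ^ a                                   ≡⟨ cong (h ^_) (m≡m%n+[m/n]*n a ℓ) ⟩
    h ^ (a % ℓ ℕ.+ a / ℓ ℕ.* ℓ)             ≡⟨ ^-homo-* h (a % ℓ) (a / ℓ ℕ.* ℓ) ⟩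
    h ^ (a % ℓ) * h ^ (a / ℓ ℕ.* ℓ)         ≡⟨ cong (λ n → h ^ (a % ℓ) * h ^ n) (ℕₚ.*-comm (a / ℓ) ℓ) ⟩
    h ^ (a % ℓ) * h ^ (ℓ ℕ.* (a / ℓ))       ≡⟨ cong (h ^ (a % ℓ) *_) (^-assocʳ h ℓ (a / ℓ)) ⟨
    h ^ (a % ℓ) * (h ^ ℓ) ^ (a / ℓ)         ≡⟨ cong (λ x → h ^ (a % ℓ) * x ^ (a / ℓ)) (proj₁ h-order) ⟩
    h ^ (a % ℓ) * 1F ^ (a / ℓ)              ≡⟨ trans (cong (h ^ (a % ℓ) *_) (1^n≡1 (a / ℓ))) (*-identityʳ _) ⟩
    h ^ (a % ℓ)                             ∎)

  h^-congₘ : ∀ {a b} → a ≡ₘ b → h ^ a ≡ h ^ b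
  h^-congₘ {a} {b} a≡b = trans (sym (h^-%ℓ a)) (trans (cong (h ^_) a≡b) (h^-%ℓ b))

  h^-injective-< : ∀ {a b} → a < b → b < ℓ → h ^ a ≢ h ^ b
  h^-injective-< {a} {b} a<b b<ℓ hᵃ≡hᵇ =
    proj₂ h-order (b ∸ a) (ℕₚ.m<n⇒0<n∸m a<b) (ℕₚ.≤-<-trans (ℕₚ.m∸n≤m b a) b<ℓ) (*-cancelˡ (^≢0 a h≢0) (begin
      h ^ a * h ^ (b ∸ a)       ≡⟨ ^-homo-* h a (b ∸ a) ⟨
      h ^ (a ℕ.+ (b ∸ a))       ≡⟨ cong (h ^_) (ℕₚ.m+[n∸m]≡n (ℕₚ.<⇒≤ a<b)) ⟩
      h ^ b                     ≡⟨ trans (sym hᵃ≡hᵇ) (sym (*-identityʳ _)) ⟩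
      h ^ a * 1F                ∎))

  h^-injectiveₘ : ∀ {a b} → h ^ a ≡ h ^ b → a ≡ₘ b
  h^-injectiveₘ {a} {b} hᵃ≡hᵇ with ℕₚ.<-cmp (a % ℓ) (b % ℓ)
  ... | tri≈ _ a≡b _ = a≡b
  ... | tri< a<b _ _ = ⊥-elim (h^-injective-< a<b (m%n<n b ℓ) (trans (h^-%ℓ a) (trans hᵃ≡hᵇ (sym (h^-%ℓ b)))))
  ... | tri> _ _ b<a = ⊥-elim (h^-injective-< b<a (m%n<n a ℓ) (trans (h^-%ℓ b) (trans (sym hᵃ≡hᵇ) (sym (h^-%ℓ a)))))

module AffineGroupProperties {q : ℕ} (F : FiniteField q) (ℓ : ℕ) .{{_ : NonZero ℓ}}
                             (h : FiniteField.Carrier F) (h-order : FiniteField.HasOrder F h ℓ) where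

  open FieldProperties F
  open Modular ℓ
  open ElementOfOrder F ℓ h h-order
  open AffineGroup F ℓ h public using (G; _·_; bElt; wElt)

  mk : ℕ → Carrier → G
  mk a c = (a mod ℓ , c)

  exponent : G → ℕ
  exponent (i , _) = toℕ i

  e : G
  e = mk 0 0F

  exponent-mk : ∀ a c → exponent (mk a c) ≡ a % ℓ
  exponent-mk a c = Fin.toℕ-fromℕ< _

  mk-cong : ∀ {a b c c′} → a ≡ₘ b → c ≡ c′ → mk a c ≡ mk b c′
  mk-cong {a} {b} {c} {c′} a≡b c≡c′ = cong₂ _,_ (Fin.toℕ-injective (trans (exponent-mk a c) (trans a≡b (sym (exponent-mk b c′))))) c≡c′

  mk-exponent : ∀ g → mk (exponent g) (proj₂ g) ≡ g
  mk-exponent (i , c) = cong (_, c) (Fin.toℕ-injective (trans (exponent-mk (toℕ i) c) (m<n⇒m%n≡m (Fin.toℕ<n i))))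

  G-enumeration : Fin (ℓ ℕ.* q) ↔ G
  G-enumeration = (↔-id (Fin ℓ) ×-↔ enumeration) ↔-∘ Fin.*↔×

  mk·mk : ∀ a b c c′ → mk a c · mk b c′ ≡ mk (a ℕ.+ b) (h ^ b * c + c′)
  mk·mk a b c c′ = mk-cong
    (trans (cong₂ (λ u v → (u ℕ.+ v) % ℓ) (exponent-mk a c) (exponent-mk b c′)) (sym (%-distribˡ-+ a b ℓ)))
    (cong (λ x → x * c + c′) (trans (cong (h ^_) (exponent-mk b c′)) (h^-%ℓ b)))

  mk·mk0 : ∀ a b c → mk a 0F · mk b c ≡ mk (a ℕ.+ b) c
  mk·mk0 a b c = trans (mk·mk a b 0F c) (cong (mk (a ℕ.+ b)) (trans (cong (_+ c) (zeroʳ _)) (+-identityˡ c)))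

  ·-assoc : ∀ x y z → (x · y) · z ≡ x · (y · z)
  ·-assoc x y z = begin
    (x · y) · z                                   ≡⟨ cong ((x · y) ·_) (mk-exponent z) ⟨
    mk (a ℕ.+ b) (h ^ b * c + c′) · mk d c″        ≡⟨ mk·mk (a ℕ.+ b) d _ c″ ⟩
    mk (a ℕ.+ b ℕ.+ d) (h ^ d * (h ^ b * c + c′) + c″)
      ≡⟨ mk-cong (cong (_% ℓ) (ℕₚ.+-assoc a b d)) (trans
           (solve 5 (λ x y c c′ c″ → y :* (x :* c :+ c′) :+ c″ := y :* x :* c :+ (y :* c′ :+ c″)) refl (h ^ b) (h ^ d) c c′ c″)
           (cong (λ t → t * c + (h ^ d * c′ + c″)) (trans (*-comm (h ^ d) (h ^ b)) (sym (^-homo-* h b d))))) ⟩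
    mk (a ℕ.+ (b ℕ.+ d)) (h ^ (b ℕ.+ d) * c + (h ^ d * c′ + c″)) ≡⟨ mk·mk a (b ℕ.+ d) c _ ⟨
    mk a c · mk (b ℕ.+ d) (h ^ d * c′ + c″)        ≡⟨ cong (_· (y · z)) (mk-exponent x) ⟩
    x · (y · z)                                   ∎
    where
    a = exponent x
    b = exponent y
    d = exponent z
    c = proj₂ x
    c′ = proj₂ y
    c″ = proj₂ z

  ·-identityˡ : ∀ x → e · x ≡ x
  ·-identityˡ x = trans (cong (e ·_) (sym (mk-exponent x))) (trans (mk·mk0 0 (exponent x) (proj₂ x)) (mk-exponent x))

  ·-cancelʳ : ∀ x y z → y · x ≡ z · x → y ≡ z
  ·-cancelʳ x y@(i , c) z@(i′ , c′) yx≡zx = cong₂ _,_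
    (Fin.toℕ-injective (≡ₘ⇒≡ (Fin.toℕ<n i) (Fin.toℕ<n i′) (+-cancelʳₘ (toℕ i) (toℕ i′) (exponent x)
      (trans (sym (exponent-mk _ c)) (trans (cong exponent yx≡zx) (exponent-mk _ c′))))))
    (*-cancelˡ (^≢0 (exponent x) h≢0) (+-cancelʳ (proj₂ x) _ _ (cong proj₂ yx≡zx)))

  bElt≡mk : ∀ i c → bElt i c ≡ mk i c
  bElt≡mk i c = trans (mk·mk0 i 0 c) (mk-cong (cong (_% ℓ) (ℕₚ.+-identityʳ i)) refl)

  wElt≡mk : ∀ i j c → wElt i j c ≡ mk (j ℕ.+ (ℓ ∸ i)) (h ^ (j ℕ.+ (ℓ ∸ i)) * - c)
  wElt≡mk i j c = trans (mk·mk 0 (j ℕ.+ (ℓ ∸ i)) (- c) 0F) (cong (mk (j ℕ.+ (ℓ ∸ i))) (+-identityʳ _))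

  bElt·wElt≡mk : ∀ {i} j c → i ≤ ℓ → bElt i c · wElt i j c ≡ mk j 0F
  bElt·wElt≡mk {i} j c i≤ℓ = begin
    bElt i c · wElt i j c                        ≡⟨ cong₂ _·_ (bElt≡mk i c) (wElt≡mk i j c) ⟩
    mk i c · mk E (h ^ E * - c)                  ≡⟨ mk·mk i E c _ ⟩
    mk (i ℕ.+ E) (h ^ E * c + h ^ E * - c)
      ≡⟨ mk-cong (trans (cong (_% ℓ) (ℕₚ.+-comm i E)) ([j+[ℓ∸i]]+i≡ₘj j i≤ℓ)) x*c+x*-c≡0 ⟩
    mk j 0F                                      ∎
    where
    E = j ℕ.+ (ℓ ∸ i)
    x*c+x*-c≡0 : h ^ E * c + h ^ E * - c ≡ 0F
    x*c+x*-c≡0 = trans (sym (distribˡ (h ^ E) c (- c))) (trans (cong (h ^ E *_) (-‿inverseʳ c)) (zeroʳ _))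

  mk0·mk0 : ∀ y u → mk 0 y · mk 0 u ≡ mk 0 (y + u)
  mk0·mk0 y u = trans (mk·mk 0 0 y u) (cong (λ t → mk 0 (t + u)) (*-identityˡ y))

  mk·mk0·mk : ∀ a b y → mk a 0F · (mk 0 y · mk b 0F) ≡ mk (a ℕ.+ b) (h ^ b * y)
  mk·mk0·mk a b y = begin
    mk a 0F · (mk 0 y · mk b 0F)       ≡⟨ cong (mk a 0F ·_) (mk·mk 0 b y 0F) ⟩
    mk a 0F · mk b (h ^ b * y + 0F)    ≡⟨ mk·mk0 a b _ ⟩
    mk (a ℕ.+ b) (h ^ b * y + 0F)      ≡⟨ cong (mk (a ℕ.+ b)) (+-identityʳ _) ⟩
    mk (a ℕ.+ b) (h ^ b * y)           ∎

module Isomorphism⇒Exponents {p d′ : ℕ} (p-prime : Prime p) (F : FiniteField (p ℕ.^ suc d′))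
               (ℓ : ℕ) .{{_ : NonZero ℓ}} (ℓ∣p^d∸1 : ℓ ∣ p ℕ.^ suc d′ ∸ 1)
               (h : FiniteField.Carrier F) (h-order : FiniteField.HasOrder F h ℓ)
               {c₁ c₂ : FiniteField.Carrier F} (c₂≢0 : c₂ ≢ FiniteField.0F F)
               {i₁ i₂ j₁ j₂ : ℕ} (i₁≤ℓ : i₁ ≤ ℓ) (i₂≤ℓ : i₂ ≤ ℓ) (j₁⊥ℓ : Coprime j₁ ℓ)
               (φ : AffineGroup.G F ℓ h → AffineGroup.G F ℓ h) where

  open FieldProperties F
  open Frobenius {d = suc d′} p-prime F
  open Modular ℓ
  open ElementOfOrder F ℓ h h-order
  open AffineGroupProperties F ℓ h h-order
  open Intertwining _·_ e ·-assoc ·-identityˡ ·-cancelʳ φ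

  module _ (φ-b : Intertwines (bElt i₁ c₁) (bElt i₂ c₂)) (φ-w : Intertwines (wElt i₁ j₁ c₁) (wElt i₂ j₂ c₂)) where

    φ-h^j : Intertwines (mk j₁ 0F) (mk j₂ 0F)
    φ-h^j = subst₂ Intertwines (bElt·wElt≡mk j₁ c₁ i₁≤ℓ) (bElt·wElt≡mk j₂ c₂ i₂≤ℓ) (intertwines-· φ-b φ-w)

    φ-h^nj : ∀ n → Intertwines (mk (n ℕ.* j₁) 0F) (mk (n ℕ.* j₂) 0F)
    φ-h^nj zero    = intertwines-e
    φ-h^nj (suc n) = subst₂ Intertwines (mk·mk0 j₁ (n ℕ.* j₁) 0F) (mk·mk0 j₂ (n ℕ.* j₂) 0F) (intertwines-· φ-h^j (φ-h^nj n))

    m : ℕ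
    m = proj₁ (solve-linearₘ j₁⊥ℓ i₁≤ℓ)

    mj₁+i₁≡ₘ0 : m ℕ.* j₁ ℕ.+ i₁ ≡ₘ 0
    mj₁+i₁≡ₘ0 = proj₂ (solve-linearₘ j₁⊥ℓ i₁≤ℓ)

    a : ℕ
    a = m ℕ.* j₂ ℕ.+ i₂

    φ-c₁ : Intertwines (mk 0 c₁) (mk a c₂)
    φ-c₁ = subst₂ Intertwines
      (trans (cong (mk (m ℕ.* j₁) 0F ·_) (bElt≡mk i₁ c₁)) (trans (mk·mk0 (m ℕ.* j₁) i₁ c₁) (mk-cong mj₁+i₁≡ₘ0 refl)))
      (trans (cong (mk (m ℕ.* j₂) 0F ·_) (bElt≡mk i₂ c₂)) (mk·mk0 (m ℕ.* j₂) i₂ c₂))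
      (intertwines-· (φ-h^nj m) φ-b)

    φ-n×c₁ : ∀ n → ∃ λ c → Intertwines (mk 0 (n ×ₙ c₁)) (mk (n ℕ.* a) c)
    φ-n×c₁ zero    = 0F , intertwines-e
    φ-n×c₁ (suc n) with c , φ-n ← φ-n×c₁ n =
      _ , subst₂ Intertwines (mk0·mk0 c₁ (n ×ₙ c₁)) (mk·mk a (n ℕ.* a) c₂ c) (intertwines-· φ-c₁ φ-n)

    -- The translation by c₁ has order p, so the p-th power of h^a x_{c₂}, of exponent pa, is trivial too.
    a≡ₘ0 : a ≡ₘ 0
    a≡ₘ0 with c , φ-p ← φ-n×c₁ p = coprime-*≡ₘ0 (∣m^[1+d]∸1⇒coprime {d = d′} (ℕ.>-nonZero⁻¹ p) ℓ∣p^d∸1) (begin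
      (p ℕ.* a) % ℓ               ≡⟨ exponent-mk (p ℕ.* a) c ⟨
      exponent (mk (p ℕ.* a) c)   ≡⟨ cong exponent (intertwines-unique (subst (λ y → Intertwines (mk 0 y) _) (p×x≡0 c₁) φ-p) intertwines-e) ⟩
      exponent e                  ≡⟨ exponent-mk 0 0F ⟩
      0 % ℓ                       ∎)

    infix 4 _∼_
    _∼_ : Carrier → Carrier → Set
    y ∼ y′ = Intertwines (mk 0 y) (mk 0 y′)

    c₁∼c₂ : c₁ ∼ c₂
    c₁∼c₂ = subst (Intertwines (mk 0 c₁)) (mk-cong a≡ₘ0 refl) φ-c₁

    ∼-+ : ∀ {y y′ u u′} → y ∼ y′ → u ∼ u′ → (y + u) ∼ (y′ + u′)
    ∼-+ y∼y′ u∼u′ = subst₂ Intertwines (mk0·mk0 _ _) (mk0·mk0 _ _) (intertwines-· y∼y′ u∼u′)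

    ∼-×ₙ : ∀ n {y y′} → y ∼ y′ → (n ×ₙ y) ∼ (n ×ₙ y′)
    ∼-×ₙ zero    _    = intertwines-e
    ∼-×ₙ (suc n) y∼y′ = ∼-+ y∼y′ (∼-×ₙ n y∼y′)

    -- h^{−j} x_u h^j = x_{h^j u} for the translation x_u, with h^{−j} = h^{(ℓ−1)j}.
    ∼-h^j : ∀ {y y′} → y ∼ y′ → (h ^ j₁ * y) ∼ (h ^ j₂ * y′)
    ∼-h^j {y} {y′} y∼y′ =
      subst₂ Intertwines (conjugate j₁ y) (conjugate j₂ y′) (intertwines-· (φ-h^nj (ℓ ∸ 1)) (intertwines-· y∼y′ φ-h^j))
      where
      conjugate : ∀ j u → mk ((ℓ ∸ 1) ℕ.* j) 0F · (mk 0 u · mk j 0F) ≡ mk 0 (h ^ j * u)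
      conjugate j u = trans (mk·mk0·mk ((ℓ ∸ 1) ℕ.* j) j u) (mk-cong ([ℓ∸1]*j+j≡ₘ0 j) refl)

    ∼-unique : ∀ {y′} → 0F ∼ y′ → y′ ≡ 0F
    ∼-unique 0∼y′ = cong proj₂ (intertwines-unique 0∼y′ intertwines-e)

    ∼-evalMonic : ∀ {cs} → All (λ a → ∃ λ n → a ≡ n ×ₙ 1F) cs → (evalMonic cs (h ^ j₁) * c₁) ∼ (evalMonic cs (h ^ j₂) * c₂)
    ∼-evalMonic []                                = subst₂ _∼_ (sym (*-identityˡ c₁)) (sym (*-identityˡ c₂)) c₁∼c₂
    ∼-evalMonic {_ ∷ cs} ((n , refl) ∷ cs∈𝔽ₚ) =
      subst₂ _∼_ (sym (horner (h ^ j₁) c₁)) (sym (horner (h ^ j₂) c₂)) (∼-+ (∼-×ₙ n c₁∼c₂) (∼-h^j (∼-evalMonic cs∈𝔽ₚ)))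
      where
      horner : ∀ ζ c → (n ×ₙ 1F + ζ * evalMonic cs ζ) * c ≡ n ×ₙ c + ζ * (evalMonic cs ζ * c)
      horner ζ c = begin
        (n ×ₙ 1F + ζ * evalMonic cs ζ) * c         ≡⟨ distribʳ c (n ×ₙ 1F) _ ⟩
        n ×ₙ 1F * c + ζ * evalMonic cs ζ * c       ≡⟨ cong₂ _+_ (trans (×-assoc-* n 1F c) (cong (n ×ₙ_) (*-identityˡ c))) (*-assoc ζ _ c) ⟩
        n ×ₙ c + ζ * (evalMonic cs ζ * c)          ∎

    f : List Carrier
    f = conjugatePolynomial (suc d′) (h ^ j₁)

    h^j₁-fixed : frob (suc d′) (h ^ j₁) ≡ h ^ j₁
    h^j₁-fixed = trans (^-assocʳ h j₁ (p ℕ.^ suc d′))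
      (h^-congₘ (trans (*-congₘ {j₁} refl (∣∸1⇒≡ₘ1 (ℕₚ.m^n>0 p (suc d′)) ℓ∣p^d∸1)) (cong (_% ℓ) (ℕₚ.*-identityʳ j₁))))

    h^j₂-root : evalMonic f (h ^ j₂) ≡ 0F
    h^j₂-root = *-cancelʳ c₂≢0 (trans (∼-unique f[h^j₁]c₁∼f[h^j₂]c₂) (sym (zeroˡ c₂)))
      where
      f[h^j₁]c₁≡0 : evalMonic f (h ^ j₁) * c₁ ≡ 0F
      f[h^j₁]c₁≡0 = trans (cong (_* c₁) (conjugatePolynomial-root d′ (h ^ j₁))) (zeroˡ c₁)
      f[h^j₁]c₁∼f[h^j₂]c₂ : 0F ∼ evalMonic f (h ^ j₂) * c₂
      f[h^j₁]c₁∼f[h^j₂]c₂ = subst (_∼ evalMonic f (h ^ j₂) * c₂) f[h^j₁]c₁≡0 (∼-evalMonic (conjugatePolynomial-∈𝔽ₚ d′ (h ^ j₁) h^j₁-fixed))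

    conjugate-exponents : ∃ λ k → k < suc d′ × (i₂ % ℓ ≡ (i₁ ℕ.* p ℕ.^ k) % ℓ) × (j₂ % ℓ ≡ (j₁ ℕ.* p ℕ.^ k) % ℓ)
    conjugate-exponents =
      let k , k<d , h^j₂≡ = conjugatePolynomial-root⁻ (suc d′) (h ^ j₁) h^j₂-root
          j₂≡ = h^-injectiveₘ (trans h^j₂≡ (^-assocʳ h j₁ (p ℕ.^ k)))
      in  k , k<d , scale-solutionₘ {m} {j₁} {i₁} {j₂} {i₂} {p ℕ.^ k} mj₁+i₁≡ₘ0 a≡ₘ0 j₂≡ , j₂≡

module Exponents⇒Isomorphism {p d : ℕ} (p-prime : Prime p) (F : FiniteField (p ℕ.^ d))
                (ℓ : ℕ) .{{_ : NonZero ℓ}} (ℓ∣p^d∸1 : ℓ ∣ p ℕ.^ d ∸ 1)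
                (h : FiniteField.Carrier F) (h-order : FiniteField.HasOrder F h ℓ)
                {c₁ c₂ : FiniteField.Carrier F} (c₁≢0 : c₁ ≢ FiniteField.0F F) (c₂≢0 : c₂ ≢ FiniteField.0F F)
                {i₁ i₂ j₁ j₂ : ℕ} (i₁≤ℓ : i₁ ≤ ℓ) (i₂≤ℓ : i₂ ≤ ℓ)
                {k : ℕ} (k≤d : k ≤ d)
                (i₂≡ : i₂ % ℓ ≡ (i₁ ℕ.* p ℕ.^ k) % ℓ) (j₂≡ : j₂ % ℓ ≡ (j₁ ℕ.* p ℕ.^ k) % ℓ) where

  open FieldProperties F
  open Frobenius {d = d} p-prime F
  open Modular ℓ
  open ElementOfOrder F ℓ h h-order
  open AffineGroupProperties F ℓ h h-order
  open AffineGroup F ℓ h using (D)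

  scale : Carrier
  scale = c₂ * proj₁ (inverse (frob k c₁) (^≢0 (p ℕ.^ k) c₁≢0))

  scale*frob[c₁]≡c₂ : scale * frob k c₁ ≡ c₂
  scale*frob[c₁]≡c₂ = begin
    c₂ * u * frob k c₁      ≡⟨ *-assoc c₂ u (frob k c₁) ⟩
    c₂ * (u * frob k c₁)    ≡⟨ cong (c₂ *_) (trans (*-comm u (frob k c₁)) (proj₂ (inverse (frob k c₁) (^≢0 (p ℕ.^ k) c₁≢0)))) ⟩
    c₂ * 1F                 ≡⟨ *-identityʳ c₂ ⟩
    c₂                      ∎
    where
    u = proj₁ (inverse (frob k c₁) (^≢0 (p ℕ.^ k) c₁≢0))

  scale≢0 : scale ≢ 0F
  scale≢0 scale≡0 = c₂≢0 (trans (sym scale*frob[c₁]≡c₂) (trans (cong (_* frob k c₁) scale≡0) (zeroˡ _)))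

  τ : G → G
  τ g = mk (exponent g ℕ.* p ℕ.^ k) (scale * frob k (proj₂ g))

  τ-mk : ∀ a c → τ (mk a c) ≡ mk (a ℕ.* p ℕ.^ k) (scale * frob k c)
  τ-mk a c = mk-cong (*-congₘ (trans (cong (_% ℓ) (exponent-mk a c)) (m%n%n≡m%n a ℓ)) refl) refl

  τ-hom : ∀ g g′ → τ (g · g′) ≡ τ g · τ g′
  τ-hom g g′ = begin
    τ (mk (a ℕ.+ a′) (h ^ a′ * c + c′))                                 ≡⟨ τ-mk (a ℕ.+ a′) _ ⟩
    mk ((a ℕ.+ a′) ℕ.* P) (scale * frob k (h ^ a′ * c + c′))            ≡⟨ mk-cong (cong (_% ℓ) (ℕₚ.*-distribʳ-+ P a a′)) value ⟩
    mk (a ℕ.* P ℕ.+ a′ ℕ.* P) (h ^ (a′ ℕ.* P) * (scale * frob k c) + scale * frob k c′) ≡⟨ mk·mk (a ℕ.* P) (a′ ℕ.* P) _ _ ⟨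
    τ g · τ g′                                                          ∎
    where
    a = exponent g
    a′ = exponent g′
    c = proj₂ g
    c′ = proj₂ g′
    P = p ℕ.^ k
    value : scale * frob k (h ^ a′ * c + c′) ≡ h ^ (a′ ℕ.* P) * (scale * frob k c) + scale * frob k c′
    value = begin
      scale * frob k (h ^ a′ * c + c′)                      ≡⟨ cong (scale *_) (trans (frob-+ k _ c′) (cong (_+ frob k c′) (frob-* k _ c))) ⟩
      scale * (frob k (h ^ a′) * frob k c + frob k c′)      ≡⟨ cong (λ x → scale * (x * frob k c + frob k c′)) (^-assocʳ h a′ P) ⟩
      scale * (h ^ (a′ ℕ.* P) * frob k c + frob k c′)
        ≡⟨ solve 4 (λ s x f g → s :* (x :* f :+ g) := x :* (s :* f) :+ s :* g) refl scale (h ^ (a′ ℕ.* P)) (frob k c) (frob k c′) ⟩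
      h ^ (a′ ℕ.* P) * (scale * frob k c) + scale * frob k c′ ∎

  τ-bElt : τ (bElt i₁ c₁) ≡ bElt i₂ c₂
  τ-bElt = begin
    τ (bElt i₁ c₁)                          ≡⟨ cong τ (bElt≡mk i₁ c₁) ⟩
    τ (mk i₁ c₁)                            ≡⟨ τ-mk i₁ c₁ ⟩
    mk (i₁ ℕ.* p ℕ.^ k) (scale * frob k c₁) ≡⟨ mk-cong (sym i₂≡) scale*frob[c₁]≡c₂ ⟩
    mk i₂ c₂                                ≡⟨ bElt≡mk i₂ c₂ ⟨
    bElt i₂ c₂                              ∎

  τ-wElt : τ (wElt i₁ j₁ c₁) ≡ wElt i₂ j₂ c₂
  τ-wElt = begin
    τ (wElt i₁ j₁ c₁)                                 ≡⟨ cong τ (wElt≡mk i₁ j₁ c₁) ⟩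
    τ (mk E₁ (h ^ E₁ * - c₁))                         ≡⟨ τ-mk E₁ _ ⟩
    mk (E₁ ℕ.* P) (scale * frob k (h ^ E₁ * - c₁))    ≡⟨ mk-cong E₁P≡E₂ value ⟩
    mk E₂ (h ^ E₂ * - c₂)                             ≡⟨ wElt≡mk i₂ j₂ c₂ ⟨
    wElt i₂ j₂ c₂                                     ∎
    where
    P = p ℕ.^ k
    E₁ = j₁ ℕ.+ (ℓ ∸ i₁)
    E₂ = j₂ ℕ.+ (ℓ ∸ i₂)
    E₁P≡E₂ : E₁ ℕ.* P ≡ₘ E₂
    E₁P≡E₂ = +-cancelʳₘ (E₁ ℕ.* P) E₂ (i₁ ℕ.* P) (begin
      (E₁ ℕ.* P ℕ.+ i₁ ℕ.* P) % ℓ     ≡⟨ cong (_% ℓ) (ℕₚ.*-distribʳ-+ P E₁ i₁) ⟨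
      ((E₁ ℕ.+ i₁) ℕ.* P) % ℓ         ≡⟨ *-congₘ ([j+[ℓ∸i]]+i≡ₘj j₁ i₁≤ℓ) refl ⟩
      (j₁ ℕ.* P) % ℓ                  ≡⟨ j₂≡ ⟨
      j₂ % ℓ                          ≡⟨ [j+[ℓ∸i]]+i≡ₘj j₂ i₂≤ℓ ⟨
      (E₂ ℕ.+ i₂) % ℓ                 ≡⟨ +-congₘ {E₂} refl i₂≡ ⟩
      (E₂ ℕ.+ i₁ ℕ.* P) % ℓ           ∎)
    value : scale * frob k (h ^ E₁ * - c₁) ≡ h ^ E₂ * - c₂
    value = begin
      scale * frob k (h ^ E₁ * - c₁)              ≡⟨ cong (scale *_) (trans (frob-* k _ _) (cong₂ _*_ (^-assocʳ h E₁ P) (frob-‿ k c₁))) ⟩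
      scale * (h ^ (E₁ ℕ.* P) * - frob k c₁)
        ≡⟨ solve 3 (λ s x y → s :* (x :* y) := x :* (s :* y)) refl scale (h ^ (E₁ ℕ.* P)) (- frob k c₁) ⟩
      h ^ (E₁ ℕ.* P) * (scale * - frob k c₁)      ≡⟨ cong (h ^ (E₁ ℕ.* P) *_) (-‿distribʳ-* scale (frob k c₁)) ⟨
      h ^ (E₁ ℕ.* P) * - (scale * frob k c₁)      ≡⟨ cong₂ (λ x y → x * - y) (h^-congₘ E₁P≡E₂) scale*frob[c₁]≡c₂ ⟩
      h ^ E₂ * - c₂                               ∎

  τ-injective : Injective _≡_ _≡_ τ
  τ-injective {i , c} {i′ , c′} τx≡τy = cong₂ _,_
    (Fin.toℕ-injective (≡ₘ⇒≡ (Fin.toℕ<n i) (Fin.toℕ<n i′) (*-cancelʳₘ pᵏ-unit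
      (trans (sym (exponent-mk _ (scale * frob k c))) (trans (cong exponent τx≡τy) (exponent-mk _ (scale * frob k c′)))))))
    (frob-injective k (*-cancelˡ scale≢0 (cong proj₂ τx≡τy)))
    where
    pᵏ-unit : p ℕ.^ k ℕ.* p ℕ.^ (d ∸ k) ≡ₘ 1
    pᵏ-unit = trans (cong (_% ℓ) (trans (sym (ℕₚ.^-distribˡ-+-* p k (d ∸ k))) (cong (p ℕ.^_) (ℕₚ.m+[n∸m]≡n k≤d))))
                    (∣∸1⇒≡ₘ1 (ℕₚ.m^n>0 p d) ℓ∣p^d∸1)

  isomorphism : D (bElt i₁ c₁) (wElt i₁ j₁ c₁) ≅D D (bElt i₂ c₂) (wElt i₂ j₂ c₂)
  isomorphism = injective⇒↔ G-enumeration τ τ-injective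
              , (λ g → trans (τ-hom _ g) (cong (_· τ g) τ-bElt))
              , (λ g → trans (τ-hom _ g) (cong (_· τ g) τ-wElt))

open import Data.Nat using (_*_; _^_)

mainTheorem8 : (p d ℓ : ℕ) → Prime p → 1 ≤ d → PrimitiveDivisor ℓ p d → .{{_ : NonZero ℓ}} →
    (F : FiniteField (p ^ d)) → (h : FiniteField.Carrier F) → FiniteField.HasOrder F h ℓ →
    (c₁ c₂ : FiniteField.Carrier F) →
    ¬ (c₁ ≡ FiniteField.0F F) → ¬ (c₂ ≡ FiniteField.0F F) →
    (i₁ i₂ j₁ j₂ : ℕ) → i₁ < ℓ → i₂ < ℓ → j₁ < ℓ → j₂ < ℓ →
    gcd j₁ ℓ ≡ 1 → gcd j₂ ℓ ≡ 1 →
    (AffineGroup.D F ℓ h (AffineGroup.bElt F ℓ h i₁ c₁) (AffineGroup.wElt F ℓ h i₁ j₁ c₁)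
      ≅D AffineGroup.D F ℓ h (AffineGroup.bElt F ℓ h i₂ c₂) (AffineGroup.wElt F ℓ h i₂ j₂ c₂))
    ⇔ (∃ λ k → k < d × (i₂ % ℓ ≡ (i₁ * p ^ k) % ℓ) × (j₂ % ℓ ≡ (j₁ * p ^ k) % ℓ))
mainTheorem8 p (suc d′) ℓ p-prime (s≤s z≤n) (ℓ∣p^d∸1 , _) F h h-order c₁ c₂ c₁≢0 c₂≢0
             i₁ i₂ j₁ j₂ i₁<ℓ i₂<ℓ _ _ gcd[j₁,ℓ]≡1 _ =
  mk⇔ (λ (φ , φ-b , φ-w) → Isomorphism⇒Exponents.conjugate-exponents p-prime F ℓ ℓ∣p^d∸1 h h-order c₂≢0 i₁≤ℓ i₂≤ℓ
                             (gcd≡1⇒coprime gcd[j₁,ℓ]≡1) (Inverse.to φ) φ-b φ-w)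
      (λ (k , k<d , i₂≡ , j₂≡) → Exponents⇒Isomorphism.isomorphism p-prime F ℓ ℓ∣p^d∸1 h h-order c₁≢0 c₂≢0 i₁≤ℓ i₂≤ℓ
                                   (ℕₚ.<⇒≤ k<d) i₂≡ j₂≡)
  where
  i₁≤ℓ : i₁ ≤ ℓ
  i₁≤ℓ = ℕₚ.<⇒≤ i₁<ℓ
  i₂≤ℓ : i₂ ≤ ℓ
  i₂≤ℓ = ℕₚ.<⇒≤ i₂<ℓ
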